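{- Let $q>1$ be a prime power, $n\ge1$, and for $1\le k\le n$ let \[ P_k(x):=(-1)^kq^{\binom{k}{2}}\left(\begin{bmatrix}n\\k\end{bmatrix}_q+\frac{1-q^n}{[n-k]!_q}\sum_{j=1}^k\frac{[n-j]!_q}{[k-j]!_q}q^{j(n-k)}\,x\,(xq^{n-j+1};q)_{j-1}\right). \] For a composition $\alpha=(\alpha_1,\ldots,\alpha_m)$ of $n$ put $P_\alpha(x)=\prod_{i=1}^mP_{\alpha_i}(x)$. Then $P_\alpha(x)$ is a polynomial in $x$ of degree $n$, with leading coefficient $q^{\varepsilon(\alpha)+n(n-1)}(q^n-1)^m$, where $\varepsilon(\alpha)=\sum_{i=1}^m(\alpha_i-1)(n-\alpha_i)$, and with constant coefficient $\prod_{i=1}^m(-1)^{\alpha_i}q^{\binom{\alpha_i}{2}}\begin{bmatrix}n\\\alpha_i\end{bmatrix}_q$.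
   Context: Notation: $(x;q)_n=\prod_{i=0}^{n-1}(1-xq^i)$, $[n]!_q=(q;q)_n/(1-q)^n$, $\begin{bmatrix}n\\k\end{bmatrix}_q=[n]!_q/([k]!_q[n-k]!_q)$. A composition of $n$ is a sequence of positive integers summing to $n$. -}

module Defs where

open import Data.Nat as ℕ using (ℕ; zero; suc; _∸_)
open import Data.Nat.Combinatorics using (_C_)
open import Data.Integer using (+_)
open import Data.Rational using (ℚ; 0ℚ; 1ℚ; _+_; _*_; _-_; -_; _÷_; ≢-nonZero)
open import Data.Rational.Properties using (_≟_)
open import Data.List using (List; []; _∷_; map; foldr; upTo; length)
open import Data.Product using (_×_)
open import Relation.Nullary using (yes; no; ¬_)
open import Relation.Binary.PropositionalEquality using (_≡_)

ℕ→ℚ : ℕ → ℚ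
ℕ→ℚ k = (+ k) Data.Rational./ 1

_^ℚ_ : ℚ → ℕ → ℚ
x ^ℚ zero = 1ℚ
x ^ℚ suc k = x * (x ^ℚ k)

-- total division: x ÷' y = x / y when y ≠ 0 (and 0 otherwise; never used at y = 0 here)
_÷'_ : ℚ → ℚ → ℚ
x ÷' y with y ≟ 0ℚ
... | yes _ = 0ℚ
... | no y≢0 = _÷_ x y {{≢-nonZero y≢0}}

prodℚ : List ℚ → ℚ
prodℚ = foldr _*_ 1ℚ

qPoch : ℚ → ℚ → ℕ → ℚ
qPoch x q n = prodℚ (map (λ i → 1ℚ - x * (q ^ℚ i)) (upTo n))

qFact : ℚ → ℕ → ℚ
qFact q n = qPoch q q n ÷' ((1ℚ - q) ^ℚ n)

qBinom : ℚ → ℕ → ℕ → ℚ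
qBinom q n k = qFact q n ÷' (qFact q k * qFact q (n ∸ k))

-- Univariate polynomials over ℚ as coefficient lists (constant term first)

Poly : Set
Poly = List ℚ

coeff : Poly → ℕ → ℚ
coeff [] _ = 0ℚ
coeff (c ∷ cs) zero = c
coeff (c ∷ cs) (suc i) = coeff cs i

_+P_ : Poly → Poly → Poly
[] +P qs = qs
(p ∷ ps) +P [] = p ∷ ps
(p ∷ ps) +P (q ∷ qs) = (p + q) ∷ (ps +P qs)

scaleP : ℚ → Poly → Poly
scaleP c = map (c *_)

_*P_ : Poly → Poly → Poly
[] *P qs = []
(p ∷ ps) *P qs = scaleP p qs +P (0ℚ ∷ (ps *P qs))

constP : ℚ → Poly
constP c = c ∷ []

X : Poly
X = 0ℚ ∷ 1ℚ ∷ []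

sumP : List Poly → Poly
sumP = foldr _+P_ []

prodP : List Poly → Poly
prodP = foldr _*P_ (constP 1ℚ)

qPochP : Poly → ℚ → ℕ → Poly
qPochP y q n = prodP (map (λ i → constP 1ℚ +P scaleP (- (q ^ℚ i)) y) (upTo n))

HasDegree : Poly → ℕ → Set
HasDegree p d = (¬ coeff p d ≡ 0ℚ) × (∀ i → d ℕ.< i → coeff p i ≡ 0ℚ)

leadingCoeff : Poly → ℕ → ℚ
leadingCoeff p d = coeff p d

sign : ℕ → ℚ
sign k = (- 1ℚ) ^ℚ k

Pk : ℚ → ℕ → ℕ → Poly
Pk q n k =
  scaleP (sign k * (q ^ℚ (k C 2)))
    (constP (qBinom q n k) +P
      scaleP ((1ℚ - q ^ℚ n) ÷' qFact q (n ∸ k))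
        (sumP (map (λ i → let j = suc i in
            scaleP ((qFact q (n ∸ j) ÷' qFact q (k ∸ j)) * (q ^ℚ (j ℕ.* (n ∸ k))))
              (X *P qPochP (scaleP (q ^ℚ (suc (n ∸ j))) X) q (j ∸ 1)))
          (upTo k))))

Palpha : ℚ → ℕ → List ℕ → Poly
Palpha q n α = prodP (map (Pk q n) α)

epsilon : ℕ → List ℕ → ℕ
epsilon n α = foldr ℕ._+_ 0 (map (λ a → (a ∸ 1) ℕ.* (n ∸ a)) α)

constTerm : ℚ → ℕ → List ℕ → ℚ
constTerm q n α = prodℚ (map (λ a → sign a * (q ^ℚ (a C 2)) * qBinom q n a) α)

-- Each summand x (x q^(n-j+1); q)_(j-1) of P_k has degree j and no constant term. Hence P_k has
-- degree at most k, its constant term is (-1)^k q^C(k,2) [n k]_q, and its x^k-coefficient comes from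
-- the summand j = k alone: the top coefficient (-q^(n-k+1))^(k-1) q^C(k-1,2) of the Pochhammer factor,
-- the cancellation of [n-k]!_q and C(k,2) + C(k-1,2) = (k-1)^2 give q^((k-1)(n-k) + k(n-1)) (q^n - 1).
-- In a product degrees add and leading and constant coefficients multiply, so for a composition α
-- of n the claims follow; the leading coefficient is nonzero because q is neither 0 nor 1.

module Submission where

open import Defs
open import Algebra using (CommutativeRing)
open import Data.List using (List; []; _∷_; [_]; _++_; _∷ʳ_; map; upTo; length)
open import Data.List.Properties using (map-++; map-∘; map-cong; map-cong-local; map-id; length-upTo; upTo-∷ʳ)
open import Data.List.Relation.Unary.All as All using (All; []; _∷_)
open import Data.List.Relation.Unary.All.Properties using (applyUpTo⁺₁; applyUpTo⁺₂; map⁺)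
open import Data.Maybe using (Maybe; just; nothing)
open import Data.Nat as ℕ
  using (ℕ; zero; suc; _≤_; _<_; _∸_; z≤n; s≤s; s<s⁻¹; ≢-nonZero⁻¹; nonTrivial⇒≢1)
open import Data.Nat.Combinatorics using (_C_; nC1≡n; nCk+nC[k+1]≡[n+1]C[k+1])
open import Data.Nat.ListAction using (sum)
open import Data.Nat.Primality using (Prime; prime⇒nonZero; prime⇒nonTrivial)
open import Data.Nat.Properties
  using (≤-refl; ≤-trans; ≤-<-trans; m≤m+n; m≤n+m; *-distribʳ-+; n∸n≡0; m+[n∸m]≡n; m*n≡1⇒m≡1; m^n≡0⇒m≡0)
import Data.Integer as ℤ
import Data.Integer.Properties as ℤP
open import Data.Nat.Coprimality using (1-coprimeTo)
import Data.Nat.Coprimality as Coprime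
open import Data.Product using (_×_; _,_)
open import Data.Rational using (ℚ; mkℚ; ↥_; 0ℚ; 1ℚ; _+_; _*_; _-_; -_; 1/_; ≢-nonZero)
open import Data.Rational.Properties
  using (_≟_; +-identityˡ; +-identityʳ; *-identityˡ; *-identityʳ; *-zeroˡ; *-zeroʳ; *-assoc;
         *-inverseˡ; normalize-coprime; +-0-group; +-*-commutativeRing)
open import Function using (_∘_; id)
open import Relation.Binary.PropositionalEquality
  using (_≡_; _≢_; refl; sym; trans; cong; cong₂; subst; module ≡-Reasoning)
open import Relation.Nullary using (¬_; yes; no; contradiction)
import Tactic.RingSolver.Core.AlmostCommutativeRing as ACR
open import Tactic.RingSolver using (solve-∀)
import Data.Nat.Tactic.RingSolver as ℕ-Ring
open import Algebra.Properties.Group +-0-group using (x∙y⁻¹≈ε⇒x≈y)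
open import Algebra.Properties.CommutativeSemiring.Exp
  (CommutativeRing.commutativeSemiring +-*-commutativeRing)
  using (_^_; ^-homo-*; ^-assocʳ; ^-distrib-*)

suc-C2 : ∀ m → suc m C 2 ≡ m ℕ.+ m C 2
suc-C2 m = trans (sym (nCk+nC[k+1]≡[n+1]C[k+1] m 1)) (cong (ℕ._+ m C 2) (nC1≡n m))

C2+C2+n≡n*n : ∀ m → m C 2 ℕ.+ m C 2 ℕ.+ m ≡ m ℕ.* m
C2+C2+n≡n*n zero = refl
C2+C2+n≡n*n (suc m) = begin
  suc m C 2 ℕ.+ suc m C 2 ℕ.+ suc m       ≡⟨ cong (λ c → c ℕ.+ c ℕ.+ suc m) (suc-C2 m) ⟩
  m ℕ.+ c ℕ.+ (m ℕ.+ c) ℕ.+ suc m         ≡⟨ regroup m c ⟩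
  (c ℕ.+ c ℕ.+ m) ℕ.+ (suc m ℕ.+ m)       ≡⟨ cong (ℕ._+ (suc m ℕ.+ m)) (C2+C2+n≡n*n m) ⟩
  m ℕ.* m ℕ.+ (suc m ℕ.+ m)               ≡⟨ square m ⟩
  suc m ℕ.* suc m                         ∎
  where
  open ≡-Reasoning
  c = m C 2
  regroup : ∀ m c → m ℕ.+ c ℕ.+ (m ℕ.+ c) ℕ.+ suc m ≡ (c ℕ.+ c ℕ.+ m) ℕ.+ (suc m ℕ.+ m)
  regroup = ℕ-Ring.solve-∀
  square : ∀ m → m ℕ.* m ℕ.+ (suc m ℕ.+ m) ≡ suc m ℕ.* suc m
  square = ℕ-Ring.solve-∀

sum-map-1 : ∀ {A : Set} (xs : List A) → sum (map (λ _ → 1) xs) ≡ length xs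
sum-map-1 [] = refl
sum-map-1 (x ∷ xs) = cong suc (sum-map-1 xs)

sum-map-+ : ∀ {A : Set} (f g : A → ℕ) xs → sum (map (λ a → f a ℕ.+ g a) xs) ≡ sum (map f xs) ℕ.+ sum (map g xs)
sum-map-+ f g [] = refl
sum-map-+ f g (x ∷ xs) = trans (cong (f x ℕ.+ g x ℕ.+_) (sum-map-+ f g xs)) (interchange (f x) (g x) _ _)
  where
  interchange : ∀ a b c d → a ℕ.+ b ℕ.+ (c ℕ.+ d) ≡ a ℕ.+ c ℕ.+ (b ℕ.+ d)
  interchange = ℕ-Ring.solve-∀

sum-map-*ʳ : ∀ c xs → sum (map (ℕ._* c) xs) ≡ sum xs ℕ.* c
sum-map-*ʳ c [] = refl
sum-map-*ʳ c (x ∷ xs) = trans (cong (x ℕ.* c ℕ.+_) (sum-map-*ʳ c xs)) (sym (*-distribʳ-+ c x (sum xs)))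

≤-sum : ∀ xs → All (_≤ sum xs) xs
≤-sum [] = []
≤-sum (x ∷ xs) = m≤m+n x (sum xs) ∷ All.map (λ y≤ → ≤-trans y≤ (m≤n+m (sum xs) x)) (≤-sum xs)

^suc-≢1 : ∀ {q} → q ≢ 1 → ∀ i → q ℕ.^ suc i ≢ 1
^suc-≢1 {q} q≢1 i = q≢1 ∘ m*n≡1⇒m≡1 q (q ℕ.^ i)

prime^≢0 : ∀ {p} e → Prime p → p ℕ.^ e ≢ 0
prime^≢0 {p} e pr = ≢-nonZero⁻¹ p {{prime⇒nonZero pr}} ∘ m^n≡0⇒m≡0 p e

prime^≢1 : ∀ {p e} → Prime p → 1 ≤ e → p ℕ.^ e ≢ 1
prime^≢1 {p} {suc e} pr _ = ^suc-≢1 (nonTrivial⇒≢1 {{prime⇒nonTrivial pr}}) e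

_≢0 : ℚ → Set
x ≢0 = ¬ x ≡ 0ℚ

ℚ-ring : ACR.AlmostCommutativeRing _ _
ℚ-ring = ACR.fromCommutativeRing +-*-commutativeRing isZero
  where
  isZero : ∀ x → Maybe (0ℚ ≡ x)
  isZero x with 0ℚ ≟ x
  ... | yes 0≡x = just 0≡x
  ... | no _ = nothing

^ℚ≡^ : ∀ x m → x ^ℚ m ≡ x ^ m
^ℚ≡^ x zero = refl
^ℚ≡^ x (suc m) = cong (x *_) (^ℚ≡^ x m)

^ℚ-homo-* : ∀ x m n → x ^ℚ (m ℕ.+ n) ≡ x ^ℚ m * x ^ℚ n
^ℚ-homo-* x m n rewrite ^ℚ≡^ x (m ℕ.+ n) | ^ℚ≡^ x m | ^ℚ≡^ x n = ^-homo-* x m n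

^ℚ-assocʳ : ∀ x m n → (x ^ℚ m) ^ℚ n ≡ x ^ℚ (m ℕ.* n)
^ℚ-assocʳ x m n rewrite ^ℚ≡^ (x ^ℚ m) n | ^ℚ≡^ x m | ^ℚ≡^ x (m ℕ.* n) = ^-assocʳ x m n

^ℚ-distrib-* : ∀ x y m → (x * y) ^ℚ m ≡ x ^ℚ m * y ^ℚ m
^ℚ-distrib-* x y m rewrite ^ℚ≡^ (x * y) m | ^ℚ≡^ x m | ^ℚ≡^ y m = ^-distrib-* x y m

neg-^ℚ : ∀ x m → (- x) ^ℚ m ≡ sign m * x ^ℚ m
neg-^ℚ x m = trans (cong (_^ℚ m) (-x≡-1*x x)) (^ℚ-distrib-* (- 1ℚ) x m)
  where
  -x≡-1*x : ∀ x → - x ≡ - 1ℚ * x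
  -x≡-1*x = solve-∀ ℚ-ring

sign-*-sign : ∀ m → sign m * sign m ≡ 1ℚ
sign-*-sign zero = refl
sign-*-sign (suc m) = trans (square-neg (sign m)) (sign-*-sign m)
  where
  square-neg : ∀ s → (- 1ℚ * s) * (- 1ℚ * s) ≡ s * s
  square-neg = solve-∀ ℚ-ring

prodℚ-++ : ∀ xs ys → prodℚ (xs ++ ys) ≡ prodℚ xs * prodℚ ys
prodℚ-++ [] ys = sym (*-identityˡ _)
prodℚ-++ (x ∷ xs) ys = trans (cong (x *_) (prodℚ-++ xs ys)) (sym (*-assoc x _ _))

prodℚ-map-upTo-suc : ∀ (f : ℕ → ℚ) m → prodℚ (map f (upTo (suc m))) ≡ prodℚ (map f (upTo m)) * f m
prodℚ-map-upTo-suc f m = begin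
  prodℚ (map f (upTo (suc m)))           ≡⟨ cong (prodℚ ∘ map f) (sym (upTo-∷ʳ m)) ⟩
  prodℚ (map f (upTo m ∷ʳ m))            ≡⟨ cong prodℚ (map-++ f (upTo m) [ m ]) ⟩
  prodℚ (map f (upTo m) ++ [ f m ])      ≡⟨ prodℚ-++ (map f (upTo m)) [ f m ] ⟩
  prodℚ (map f (upTo m)) * (f m * 1ℚ)    ≡⟨ cong (prodℚ (map f (upTo m)) *_) (*-identityʳ (f m)) ⟩
  prodℚ (map f (upTo m)) * f m           ∎
  where open ≡-Reasoning

prodℚ-geometric : ∀ x c m → prodℚ (map (λ i → x ^ℚ i * c) (upTo m)) ≡ c ^ℚ m * x ^ℚ (m C 2)
prodℚ-geometric x c zero = refl
prodℚ-geometric x c (suc m) = begin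
  prodℚ (map (λ i → x ^ℚ i * c) (upTo (suc m)))  ≡⟨ prodℚ-map-upTo-suc (λ i → x ^ℚ i * c) m ⟩
  prodℚ (map (λ i → x ^ℚ i * c) (upTo m)) * (x ^ℚ m * c)
    ≡⟨ cong (_* (x ^ℚ m * c)) (prodℚ-geometric x c m) ⟩
  c ^ℚ m * x ^ℚ (m C 2) * (x ^ℚ m * c)           ≡⟨ regroup (c ^ℚ m) (x ^ℚ (m C 2)) (x ^ℚ m) c ⟩
  c * c ^ℚ m * (x ^ℚ m * x ^ℚ (m C 2))           ≡⟨ cong (c * c ^ℚ m *_) (sym (^ℚ-homo-* x m (m C 2))) ⟩
  c ^ℚ suc m * x ^ℚ (m ℕ.+ m C 2)                ≡⟨ cong (λ e → c ^ℚ suc m * x ^ℚ e) (sym (suc-C2 m)) ⟩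
  c ^ℚ suc m * x ^ℚ (suc m C 2)                  ∎
  where
  open ≡-Reasoning
  regroup : ∀ a b d c → a * b * (d * c) ≡ c * a * (d * b)
  regroup = solve-∀ ℚ-ring

prodℚ-map-^ℚ-* : ∀ {A : Set} x y (e : A → ℕ) xs →
  prodℚ (map (λ a → x ^ℚ e a * y) xs) ≡ x ^ℚ sum (map e xs) * y ^ℚ length xs
prodℚ-map-^ℚ-* x y e [] = refl
prodℚ-map-^ℚ-* x y e (a ∷ xs) = begin
  x ^ℚ e a * y * prodℚ (map (λ a → x ^ℚ e a * y) xs)     ≡⟨ cong (x ^ℚ e a * y *_) (prodℚ-map-^ℚ-* x y e xs) ⟩
  x ^ℚ e a * y * (x ^ℚ sum (map e xs) * y ^ℚ length xs)  ≡⟨ regroup (x ^ℚ e a) y (x ^ℚ sum (map e xs)) (y ^ℚ length xs) ⟩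
  x ^ℚ e a * x ^ℚ sum (map e xs) * (y * y ^ℚ length xs)  ≡⟨ cong (_* (y * y ^ℚ length xs)) (sym (^ℚ-homo-* x (e a) _)) ⟩
  x ^ℚ (e a ℕ.+ sum (map e xs)) * y ^ℚ suc (length xs)   ∎
  where
  open ≡-Reasoning
  regroup : ∀ a y b z → a * y * (b * z) ≡ a * b * (y * z)
  regroup = solve-∀ ℚ-ring

*-≢0 : ∀ {x y} → x ≢0 → y ≢0 → (x * y) ≢0
*-≢0 {x} {y} x≢0 y≢0 xy≡0 = y≢0 (begin
  y                ≡⟨ sym (*-identityˡ y) ⟩
  1ℚ * y           ≡⟨ cong (_* y) (sym (*-inverseˡ x {{≢-nonZero x≢0}})) ⟩
  x⁻¹ * x * y      ≡⟨ *-assoc x⁻¹ x y ⟩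
  x⁻¹ * (x * y)    ≡⟨ cong (x⁻¹ *_) xy≡0 ⟩
  x⁻¹ * 0ℚ         ≡⟨ *-zeroʳ x⁻¹ ⟩
  0ℚ               ∎)
  where
  open ≡-Reasoning
  x⁻¹ = (1/ x) {{≢-nonZero x≢0}}

^ℚ-≢0 : ∀ {x} m → x ≢0 → (x ^ℚ m) ≢0
^ℚ-≢0 zero x≢0 ()
^ℚ-≢0 (suc m) x≢0 = *-≢0 x≢0 (^ℚ-≢0 m x≢0)

prodℚ-map-≢0 : ∀ {A : Set} {f : A → ℚ} → (∀ a → f a ≢0) → ∀ xs → prodℚ (map f xs) ≢0
prodℚ-map-≢0 f≢0 [] ()
prodℚ-map-≢0 f≢0 (x ∷ xs) = *-≢0 (f≢0 x) (prodℚ-map-≢0 f≢0 xs)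

÷'-≡-* : ∀ x {y} (y≢0 : y ≢0) → x ÷' y ≡ x * (1/ y) {{≢-nonZero y≢0}}
÷'-≡-* x {y} y≢0 with y ≟ 0ℚ
... | yes y≡0 = contradiction y≡0 y≢0
... | no _ = refl

÷'-≢0 : ∀ {x y} → x ≢0 → y ≢0 → (x ÷' y) ≢0
÷'-≢0 {x} {y} x≢0 y≢0 rewrite ÷'-≡-* x y≢0 = *-≢0 x≢0 1/y≢0
  where
  1/y≢0 : ((1/ y) {{≢-nonZero y≢0}}) ≢0
  1/y≢0 1/y≡0 = contradiction
    (trans (sym (*-inverseˡ y {{≢-nonZero y≢0}})) (trans (cong (_* y) 1/y≡0) (*-zeroˡ y)))
    (λ ())

÷'-cancel : ∀ x {y} → y ≢0 → (x ÷' y) * y ≡ x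
÷'-cancel x {y} y≢0 rewrite ÷'-≡-* x y≢0 =
  trans (*-assoc x _ y) (trans (cong (x *_) (*-inverseˡ y {{≢-nonZero y≢0}})) (*-identityʳ x))

÷'-identityʳ : ∀ x → x ÷' 1ℚ ≡ x
÷'-identityʳ x = trans (sym (*-identityʳ (x ÷' 1ℚ))) (÷'-cancel x {1ℚ} (λ ()))

x-y≡0⇒x≡y : ∀ {x y} → x - y ≡ 0ℚ → x ≡ y
x-y≡0⇒x≡y = x∙y⁻¹≈ε⇒x≈y _ _

ℕ→ℚ≡mkℚ : ∀ k → ℕ→ℚ k ≡ mkℚ (ℤ.+ k) 0 (Coprime.sym (1-coprimeTo k))
ℕ→ℚ≡mkℚ k = normalize-coprime (Coprime.sym (1-coprimeTo k))

ℕ→ℚ-homo-* : ∀ a b → ℕ→ℚ (a ℕ.* b) ≡ ℕ→ℚ a * ℕ→ℚ b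
ℕ→ℚ-homo-* a b rewrite ℕ→ℚ≡mkℚ a | ℕ→ℚ≡mkℚ b =
  cong (Data.Rational._/ 1) (ℤP.pos-* a b)

ℕ→ℚ-injective : ∀ {a b} → ℕ→ℚ a ≡ ℕ→ℚ b → a ≡ b
ℕ→ℚ-injective {a} {b} eq rewrite ℕ→ℚ≡mkℚ a | ℕ→ℚ≡mkℚ b = ℤP.+-injective (cong ↥_ eq)

ℕ→ℚ-homo-^ : ∀ q i → ℕ→ℚ q ^ℚ i ≡ ℕ→ℚ (q ℕ.^ i)
ℕ→ℚ-homo-^ q zero = refl
ℕ→ℚ-homo-^ q (suc i) = trans (cong (ℕ→ℚ q *_) (ℕ→ℚ-homo-^ q i)) (sym (ℕ→ℚ-homo-* q (q ℕ.^ i)))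

ℕ→ℚ-≢0 : ∀ {q} → q ≢ 0 → ℕ→ℚ q ≢0
ℕ→ℚ-≢0 q≢0 = q≢0 ∘ ℕ→ℚ-injective

ℕ→ℚ-1ℚ-≢0 : ∀ {m} → m ≢ 1 → (ℕ→ℚ m - 1ℚ) ≢0
ℕ→ℚ-1ℚ-≢0 m≢1 = m≢1 ∘ ℕ→ℚ-injective ∘ x-y≡0⇒x≡y

1ℚ-ℕ→ℚ-≢0 : ∀ {m} → m ≢ 1 → (1ℚ - ℕ→ℚ m) ≢0
1ℚ-ℕ→ℚ-≢0 m≢1 = m≢1 ∘ sym ∘ ℕ→ℚ-injective ∘ x-y≡0⇒x≡y

1ℚ-ℕ→ℚ^suc-≢0 : ∀ {q} → q ≢ 1 → ∀ i → (1ℚ - ℕ→ℚ q ^ℚ suc i) ≢0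
1ℚ-ℕ→ℚ^suc-≢0 {q} q≢1 i = subst (λ t → (1ℚ - t) ≢0) (sym (ℕ→ℚ-homo-^ q (suc i))) (1ℚ-ℕ→ℚ-≢0 (^suc-≢1 q≢1 i))

ℕ→ℚ^-1ℚ-≢0 : ∀ {q n} → q ≢ 1 → 1 ≤ n → (ℕ→ℚ q ^ℚ n - 1ℚ) ≢0
ℕ→ℚ^-1ℚ-≢0 {q} {suc i} q≢1 _ = subst (λ t → (t - 1ℚ) ≢0) (sym (ℕ→ℚ-homo-^ q (suc i))) (ℕ→ℚ-1ℚ-≢0 (^suc-≢1 q≢1 i))

qFact-≢0 : ∀ {q} → q ≢ 1 → ∀ m → qFact (ℕ→ℚ q) m ≢0
qFact-≢0 q≢1 m = ÷'-≢0 (prodℚ-map-≢0 (1ℚ-ℕ→ℚ^suc-≢0 q≢1) (upTo m)) (^ℚ-≢0 m (1ℚ-ℕ→ℚ-≢0 q≢1))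

DegreeAtMost : Poly → ℕ → Set
DegreeAtMost p d = ∀ i → d < i → coeff p i ≡ 0ℚ

Vanishes : Poly → Set
Vanishes p = ∀ i → coeff p i ≡ 0ℚ

coeff-+P : ∀ p r i → coeff (p +P r) i ≡ coeff p i + coeff r i
coeff-+P [] r i = sym (+-identityˡ _)
coeff-+P (c ∷ p) [] i = sym (+-identityʳ _)
coeff-+P (c ∷ p) (d ∷ r) zero = refl
coeff-+P (c ∷ p) (d ∷ r) (suc i) = coeff-+P p r i

coeff-scaleP : ∀ c p i → coeff (scaleP c p) i ≡ c * coeff p i
coeff-scaleP c [] i = sym (*-zeroʳ c)
coeff-scaleP c (d ∷ p) zero = refl
coeff-scaleP c (d ∷ p) (suc i) = coeff-scaleP c p i

coeff-∷-*P : ∀ c p r i → coeff ((c ∷ p) *P r) i ≡ c * coeff r i + coeff (0ℚ ∷ (p *P r)) i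
coeff-∷-*P c p r i =
  trans (coeff-+P (scaleP c r) _ i) (cong (_+ coeff (0ℚ ∷ (p *P r)) i) (coeff-scaleP c r i))

coeff-*P-zero : ∀ p r → coeff (p *P r) 0 ≡ coeff p 0 * coeff r 0
coeff-*P-zero [] r = sym (*-zeroˡ (coeff r 0))
coeff-*P-zero (c ∷ p) r = trans (coeff-∷-*P c p r 0) (+-identityʳ _)

∷-vanishes : ∀ {p} → Vanishes p → Vanishes (0ℚ ∷ p)
∷-vanishes p≡0 zero = refl
∷-vanishes p≡0 (suc i) = p≡0 i

*P-vanishesˡ : ∀ p r → Vanishes p → Vanishes (p *P r)
*P-vanishesˡ [] r _ i = refl
*P-vanishesˡ (c ∷ p) r p≡0 i = begin
  coeff ((c ∷ p) *P r) i                  ≡⟨ coeff-∷-*P c p r i ⟩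
  c * coeff r i + coeff (0ℚ ∷ (p *P r)) i ≡⟨ cong₂ (λ x y → x * coeff r i + y) (p≡0 0) (∷-vanishes (*P-vanishesˡ p r (p≡0 ∘ suc)) i) ⟩
  0ℚ * coeff r i + 0ℚ                     ≡⟨ trans (+-identityʳ _) (*-zeroˡ (coeff r i)) ⟩
  0ℚ                                      ∎
  where open ≡-Reasoning

*P-degreeAtMost : ∀ p r {a b} → DegreeAtMost p a → DegreeAtMost r b → DegreeAtMost (p *P r) (a ℕ.+ b)
*P-degreeAtMost [] r _ _ _ _ = refl
*P-degreeAtMost (c ∷ p) r {a} {b} dp dr (suc i) a+b<1+i = begin
  coeff ((c ∷ p) *P r) (suc i)           ≡⟨ coeff-∷-*P c p r (suc i) ⟩
  c * coeff r (suc i) + coeff (p *P r) i ≡⟨ cong₂ (λ x y → c * x + y) (dr (suc i) b<1+i) (tail a dp a+b<1+i) ⟩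
  c * 0ℚ + 0ℚ                            ≡⟨ c*0+0≡0 c ⟩
  0ℚ                                     ∎
  where
  open ≡-Reasoning
  b<1+i = ≤-<-trans (m≤n+m b a) a+b<1+i
  c*0+0≡0 : ∀ c → c * 0ℚ + 0ℚ ≡ 0ℚ
  c*0+0≡0 = solve-∀ ℚ-ring
  tail : ∀ a → DegreeAtMost (c ∷ p) a → a ℕ.+ b < suc i → coeff (p *P r) i ≡ 0ℚ
  tail zero dp _ = *P-vanishesˡ p r (λ j → dp (suc j) (s≤s z≤n)) i
  tail (suc a) dp a+b<1+i = *P-degreeAtMost p r (λ j → dp (suc j) ∘ s≤s) dr i (s<s⁻¹ a+b<1+i)

coeff-*P-top : ∀ p r {a b} → DegreeAtMost p a → DegreeAtMost r b →
  coeff (p *P r) (a ℕ.+ b) ≡ coeff p a * coeff r b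
coeff-*P-top [] r {b = b} _ _ = sym (*-zeroˡ (coeff r b))
coeff-*P-top (c ∷ p) r {zero} {b} dp dr = begin
  coeff ((c ∷ p) *P r) b                  ≡⟨ coeff-∷-*P c p r b ⟩
  c * coeff r b + coeff (0ℚ ∷ (p *P r)) b ≡⟨ cong (λ t → c * coeff r b + t) (∷-vanishes (*P-vanishesˡ p r (λ j → dp (suc j) (s≤s z≤n))) b) ⟩
  c * coeff r b + 0ℚ                      ≡⟨ +-identityʳ _ ⟩
  c * coeff r b                           ∎
  where open ≡-Reasoning
coeff-*P-top (c ∷ p) r {suc a} {b} dp dr = begin
  coeff ((c ∷ p) *P r) (suc (a ℕ.+ b))                 ≡⟨ coeff-∷-*P c p r (suc (a ℕ.+ b)) ⟩
  c * coeff r (suc (a ℕ.+ b)) + coeff (p *P r) (a ℕ.+ b)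
    ≡⟨ cong₂ (λ x y → c * x + y) (dr _ (s≤s (m≤n+m b a))) (coeff-*P-top p r (λ j → dp (suc j) ∘ s≤s) dr) ⟩
  c * 0ℚ + coeff p a * coeff r b                       ≡⟨ cong (_+ coeff p a * coeff r b) (*-zeroʳ c) ⟩
  0ℚ + coeff p a * coeff r b                           ≡⟨ +-identityˡ _ ⟩
  coeff p a * coeff r b                                ∎
  where open ≡-Reasoning

constP-degreeAtMost : ∀ c d → DegreeAtMost (constP c) d
constP-degreeAtMost c d (suc i) _ = refl

X-degreeAtMost : DegreeAtMost X 1
X-degreeAtMost (suc (suc i)) _ = refl
X-degreeAtMost (suc zero) (s≤s ())

scaleP-degreeAtMost : ∀ c p {d} → DegreeAtMost p d → DegreeAtMost (scaleP c p) d
scaleP-degreeAtMost c p dp i d<i = trans (coeff-scaleP c p i) (trans (cong (c *_) (dp i d<i)) (*-zeroʳ c))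

+P-degreeAtMost : ∀ p r {d} → DegreeAtMost p d → DegreeAtMost r d → DegreeAtMost (p +P r) d
+P-degreeAtMost p r dp dr i d<i = trans (coeff-+P p r i) (cong₂ _+_ (dp i d<i) (dr i d<i))

coeff-sumP-vanishes : ∀ {ps i} → All (λ p → coeff p i ≡ 0ℚ) ps → coeff (sumP ps) i ≡ 0ℚ
coeff-sumP-vanishes [] = refl
coeff-sumP-vanishes {p ∷ ps} {i} (p≡0 ∷ ps≡0) =
  trans (coeff-+P p (sumP ps) i) (cong₂ _+_ p≡0 (coeff-sumP-vanishes ps≡0))

coeff-sumP-∷ʳ : ∀ {ps i} r → All (λ p → coeff p i ≡ 0ℚ) ps → coeff (sumP (ps ∷ʳ r)) i ≡ coeff r i
coeff-sumP-∷ʳ {i = i} r [] = trans (coeff-+P r [] i) (+-identityʳ _)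
coeff-sumP-∷ʳ {p ∷ ps} {i} r (p≡0 ∷ ps≡0) =
  trans (coeff-+P p _ i) (trans (cong₂ _+_ p≡0 (coeff-sumP-∷ʳ r ps≡0)) (+-identityˡ _))

module _ (g : ℕ → Poly) (g-degree : ∀ t → DegreeAtMost (g t) (suc t)) where

  upTo-terms-vanish : ∀ {m i} → m < i → All (λ p → coeff p i ≡ 0ℚ) (map g (upTo m))
  upTo-terms-vanish {m} {i} m<i = map⁺ (applyUpTo⁺₁ id m (λ t<m → g-degree _ i (≤-<-trans t<m m<i)))

  sumP-upTo-degreeAtMost : ∀ m → DegreeAtMost (sumP (map g (upTo m))) m
  sumP-upTo-degreeAtMost m i m<i = coeff-sumP-vanishes (upTo-terms-vanish m<i)

  coeff-sumP-upTo-top : ∀ m → coeff (sumP (map g (upTo (suc m)))) (suc m) ≡ coeff (g m) (suc m)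
  coeff-sumP-upTo-top m = begin
    coeff (sumP (map g (upTo (suc m)))) (suc m) ≡⟨ cong (λ ts → coeff (sumP (map g ts)) (suc m)) (sym (upTo-∷ʳ m)) ⟩
    coeff (sumP (map g (upTo m ∷ʳ m))) (suc m)  ≡⟨ cong (λ ps → coeff (sumP ps) (suc m)) (map-++ g (upTo m) [ m ]) ⟩
    coeff (sumP (map g (upTo m) ∷ʳ g m)) (suc m) ≡⟨ coeff-sumP-∷ʳ (g m) (upTo-terms-vanish ≤-refl) ⟩
    coeff (g m) (suc m)                         ∎
    where open ≡-Reasoning

module _ {A : Set} (f : A → Poly) (d : A → ℕ) (f-degree : ∀ x → DegreeAtMost (f x) (d x)) where

  prodP-degreeAtMost : ∀ xs → DegreeAtMost (prodP (map f xs)) (sum (map d xs))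
  prodP-degreeAtMost [] = constP-degreeAtMost 1ℚ 0
  prodP-degreeAtMost (x ∷ xs) = *P-degreeAtMost (f x) _ (f-degree x) (prodP-degreeAtMost xs)

  coeff-prodP-top : ∀ xs → coeff (prodP (map f xs)) (sum (map d xs)) ≡ prodℚ (map (λ x → coeff (f x) (d x)) xs)
  coeff-prodP-top [] = refl
  coeff-prodP-top (x ∷ xs) =
    trans (coeff-*P-top (f x) _ (f-degree x) (prodP-degreeAtMost xs)) (cong (coeff (f x) (d x) *_) (coeff-prodP-top xs))

coeff-prodP-zero : ∀ ps → coeff (prodP ps) 0 ≡ prodℚ (map (λ p → coeff p 0) ps)
coeff-prodP-zero [] = refl
coeff-prodP-zero (p ∷ ps) = trans (coeff-*P-zero p (prodP ps)) (cong (coeff p 0 *_) (coeff-prodP-zero ps))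

-- The q-Pochhammer polynomial (y;q)_m

module _ (y : Poly) (q : ℚ) (y-degree : DegreeAtMost y 1) where

  private
    factor : ℕ → Poly
    factor i = constP 1ℚ +P scaleP (- (q ^ℚ i)) y

    factor-degree : ∀ i → DegreeAtMost (factor i) 1
    factor-degree i =
      +P-degreeAtMost (constP 1ℚ) (scaleP (- (q ^ℚ i)) y) (constP-degreeAtMost 1ℚ 1) (scaleP-degreeAtMost (- (q ^ℚ i)) y y-degree)

    coeff-factor-top : ∀ i → coeff (factor i) 1 ≡ q ^ℚ i * - coeff y 1
    coeff-factor-top i = trans (coeff-+P (constP 1ℚ) (scaleP (- (q ^ℚ i)) y) 1)
      (trans (cong (0ℚ +_) (coeff-scaleP (- (q ^ℚ i)) y 1)) (0-a*b≡a*-b (q ^ℚ i) (coeff y 1)))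
      where
      0-a*b≡a*-b : ∀ a b → 0ℚ + - a * b ≡ a * - b
      0-a*b≡a*-b = solve-∀ ℚ-ring

    degree≡m : ∀ m → sum (map (λ _ → 1) (upTo m)) ≡ m
    degree≡m m = trans (sum-map-1 (upTo m)) (length-upTo m)

  qPochP-degreeAtMost : ∀ m → DegreeAtMost (qPochP y q m) m
  qPochP-degreeAtMost m =
    subst (DegreeAtMost (qPochP y q m)) (degree≡m m) (prodP-degreeAtMost factor (λ _ → 1) factor-degree (upTo m))

  coeff-qPochP-top : ∀ m → coeff (qPochP y q m) m ≡ (- coeff y 1) ^ℚ m * q ^ℚ (m C 2)
  coeff-qPochP-top m = begin
    coeff (qPochP y q m) m                                ≡⟨ cong (coeff (qPochP y q m)) (sym (degree≡m m)) ⟩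
    coeff (qPochP y q m) (sum (map (λ _ → 1) (upTo m)))   ≡⟨ coeff-prodP-top factor (λ _ → 1) factor-degree (upTo m) ⟩
    prodℚ (map (λ i → coeff (factor i) 1) (upTo m))       ≡⟨ cong prodℚ (map-cong coeff-factor-top (upTo m)) ⟩
    prodℚ (map (λ i → q ^ℚ i * - coeff y 1) (upTo m))     ≡⟨ prodℚ-geometric q (- coeff y 1) m ⟩
    (- coeff y 1) ^ℚ m * q ^ℚ (m C 2)                     ∎
    where open ≡-Reasoning

-- The polynomials P_k

-- Pk-term q n k i is the summand with j = i + 1 in the definition of P_k.

Pk-weight : ℚ → ℕ → ℕ → ℕ → ℚ
Pk-weight q n k i = (qFact q (n ∸ suc i) ÷' qFact q (k ∸ suc i)) * (q ^ℚ (suc i ℕ.* (n ∸ k)))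

Pk-base : ℚ → ℕ → ℕ → Poly
Pk-base q n i = scaleP (q ^ℚ suc (n ∸ suc i)) X

Pk-term : ℚ → ℕ → ℕ → ℕ → Poly
Pk-term q n k i = scaleP (Pk-weight q n k i) (X *P qPochP (Pk-base q n i) q i)

Pk-sum : ℚ → ℕ → ℕ → Poly
Pk-sum q n k = sumP (map (Pk-term q n k) (upTo k))

coeff-Pk : ∀ q n k i → coeff (Pk q n k) i ≡
  sign k * q ^ℚ (k C 2) * (coeff (constP (qBinom q n k)) i + ((1ℚ - q ^ℚ n) ÷' qFact q (n ∸ k)) * coeff (Pk-sum q n k) i)
coeff-Pk q n k i =
  trans (coeff-scaleP (sign k * q ^ℚ (k C 2)) (B +P scaleP u (Pk-sum q n k)) i)
    (cong (sign k * q ^ℚ (k C 2) *_)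
      (trans (coeff-+P B (scaleP u (Pk-sum q n k)) i)
        (cong (λ t → coeff B i + t) (coeff-scaleP u (Pk-sum q n k) i))))
  where
  B = constP (qBinom q n k)
  u = (1ℚ - q ^ℚ n) ÷' qFact q (n ∸ k)

module _ (q : ℚ) (n k : ℕ) where

  private
    base-degree : ∀ i → DegreeAtMost (Pk-base q n i) 1
    base-degree i = scaleP-degreeAtMost (q ^ℚ suc (n ∸ suc i)) X X-degreeAtMost

  Pk-term-degreeAtMost : ∀ i → DegreeAtMost (Pk-term q n k i) (suc i)
  Pk-term-degreeAtMost i = scaleP-degreeAtMost (Pk-weight q n k i) (X *P qPochP (Pk-base q n i) q i)
    (*P-degreeAtMost X (qPochP (Pk-base q n i) q i) X-degreeAtMost (qPochP-degreeAtMost (Pk-base q n i) q (base-degree i) i))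

  coeff-Pk-term-zero : ∀ i → coeff (Pk-term q n k i) 0 ≡ 0ℚ
  coeff-Pk-term-zero i = trans (coeff-scaleP c (X *P P) 0)
    (trans (cong (c *_) (trans (coeff-*P-zero X P) (*-zeroˡ (coeff P 0)))) (*-zeroʳ c))
    where
    c = Pk-weight q n k i
    P = qPochP (Pk-base q n i) q i

  coeff-Pk-term-top : ∀ i → coeff (Pk-term q n k i) (suc i) ≡
    Pk-weight q n k i * ((- q ^ℚ suc (n ∸ suc i)) ^ℚ i * q ^ℚ (i C 2))
  coeff-Pk-term-top i = begin
    coeff (scaleP c (X *P P)) (suc i)      ≡⟨ coeff-scaleP c (X *P P) (suc i) ⟩
    c * coeff (X *P P) (suc i)             ≡⟨ cong (c *_) (coeff-*P-top X P X-degreeAtMost (qPochP-degreeAtMost (Pk-base q n i) q (base-degree i) i)) ⟩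
    c * (1ℚ * coeff P i)                   ≡⟨ cong (c *_) (*-identityˡ (coeff P i)) ⟩
    c * coeff P i                          ≡⟨ cong (c *_) (coeff-qPochP-top (Pk-base q n i) q (base-degree i) i) ⟩
    c * ((- (a * 1ℚ)) ^ℚ i * q ^ℚ (i C 2)) ≡⟨ cong (λ t → c * ((- t) ^ℚ i * q ^ℚ (i C 2))) (*-identityʳ a) ⟩
    c * ((- a) ^ℚ i * q ^ℚ (i C 2))        ∎
    where
    open ≡-Reasoning
    a = q ^ℚ suc (n ∸ suc i)
    c = Pk-weight q n k i
    P = qPochP (Pk-base q n i) q i

  Pk-degreeAtMost : DegreeAtMost (Pk q n k) k
  Pk-degreeAtMost = scaleP-degreeAtMost (sign k * q ^ℚ (k C 2)) (B +P scaleP u (Pk-sum q n k))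
    (+P-degreeAtMost B (scaleP u (Pk-sum q n k)) (constP-degreeAtMost (qBinom q n k) k)
      (scaleP-degreeAtMost u (Pk-sum q n k) (sumP-upTo-degreeAtMost (Pk-term q n k) Pk-term-degreeAtMost k)))
    where
    B = constP (qBinom q n k)
    u = (1ℚ - q ^ℚ n) ÷' qFact q (n ∸ k)

  coeff-Pk-zero : coeff (Pk q n k) 0 ≡ sign k * q ^ℚ (k C 2) * qBinom q n k
  coeff-Pk-zero = begin
    coeff (Pk q n k) 0                   ≡⟨ coeff-Pk q n k 0 ⟩
    s * (qBinom q n k + u * coeff (Pk-sum q n k) 0)
      ≡⟨ cong (λ t → s * (qBinom q n k + u * t)) (coeff-sumP-vanishes (map⁺ (applyUpTo⁺₂ id k coeff-Pk-term-zero))) ⟩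
    s * (qBinom q n k + u * 0ℚ)         ≡⟨ cancel s (qBinom q n k) u ⟩
    s * qBinom q n k                     ∎
    where
    open ≡-Reasoning
    s = sign k * q ^ℚ (k C 2)
    u = (1ℚ - q ^ℚ n) ÷' qFact q (n ∸ k)
    cancel : ∀ s b u → s * (b + u * 0ℚ) ≡ s * b
    cancel = solve-∀ ℚ-ring

Pk-lead : ℚ → ℕ → ℕ → ℚ
Pk-lead q n k = q ^ℚ ((k ∸ 1) ℕ.* (n ∸ k) ℕ.+ k ℕ.* (n ∸ 1)) * (q ^ℚ n - 1ℚ)

Pk-lead-exponent : ∀ k r →
  suc k C 2 ℕ.+ suc k ℕ.* r ℕ.+ suc r ℕ.* k ℕ.+ k C 2 ≡ k ℕ.* r ℕ.+ suc k ℕ.* (k ℕ.+ r)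
Pk-lead-exponent k r = begin
  suc k C 2 ℕ.+ suc k ℕ.* r ℕ.+ suc r ℕ.* k ℕ.+ c
    ≡⟨ cong (λ t → t ℕ.+ suc k ℕ.* r ℕ.+ suc r ℕ.* k ℕ.+ c) (suc-C2 k) ⟩
  k ℕ.+ c ℕ.+ suc k ℕ.* r ℕ.+ suc r ℕ.* k ℕ.+ c              ≡⟨ regroup k r c ⟩
  (c ℕ.+ c ℕ.+ k) ℕ.+ (k ℕ.+ r ℕ.+ k ℕ.* r ℕ.+ k ℕ.* r)    ≡⟨ cong (ℕ._+ (k ℕ.+ r ℕ.+ k ℕ.* r ℕ.+ k ℕ.* r)) (C2+C2+n≡n*n k) ⟩
  k ℕ.* k ℕ.+ (k ℕ.+ r ℕ.+ k ℕ.* r ℕ.+ k ℕ.* r)            ≡⟨ expand k r ⟩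
  k ℕ.* r ℕ.+ suc k ℕ.* (k ℕ.+ r)                          ∎
  where
  open ≡-Reasoning
  c = k C 2
  regroup : ∀ k r c → k ℕ.+ c ℕ.+ suc k ℕ.* r ℕ.+ suc r ℕ.* k ℕ.+ c
                    ≡ (c ℕ.+ c ℕ.+ k) ℕ.+ (k ℕ.+ r ℕ.+ k ℕ.* r ℕ.+ k ℕ.* r)
  regroup = ℕ-Ring.solve-∀
  expand : ∀ k r → k ℕ.* k ℕ.+ (k ℕ.+ r ℕ.+ k ℕ.* r ℕ.+ k ℕ.* r) ≡ k ℕ.* r ℕ.+ suc k ℕ.* (k ℕ.+ r)
  expand = ℕ-Ring.solve-∀

-- The signs sign (suc k) and sign k turn 1 - x ^ n into x ^ n - 1, and the q-factorial F cancels.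
Pk-lead-value : ∀ x {F} → F ≢0 → ∀ n k r →
  sign (suc k) * x ^ℚ (suc k C 2)
    * (0ℚ + ((1ℚ - x ^ℚ n) ÷' F) * (F * x ^ℚ (suc k ℕ.* r) * ((- x ^ℚ suc r) ^ℚ k * x ^ℚ (k C 2))))
  ≡ x ^ℚ (k ℕ.* r ℕ.+ suc k ℕ.* (k ℕ.+ r)) * (x ^ℚ n - 1ℚ)
Pk-lead-value x {F} F≢0 n k r = begin
  - 1ℚ * sign k * a * (0ℚ + u * (F * b * ((- x ^ℚ suc r) ^ℚ k * c)))
    ≡⟨ cong (λ t → - 1ℚ * sign k * a * (0ℚ + u * (F * b * (t * c)))) (neg-^ℚ (x ^ℚ suc r) k) ⟩
  - 1ℚ * sign k * a * (0ℚ + u * (F * b * (sign k * v * c)))  ≡⟨ regroup (sign k) a u F b v c ⟩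
  sign k * sign k * (u * F) * - 1ℚ * (a * b * v * c)         ≡⟨ cong₂ (λ s w → s * w * - 1ℚ * (a * b * v * c)) (sign-*-sign k) (÷'-cancel (1ℚ - x ^ℚ n) F≢0) ⟩
  1ℚ * (1ℚ - x ^ℚ n) * - 1ℚ * (a * b * v * c)                ≡⟨ negate (x ^ℚ n) (a * b * v * c) ⟩
  a * b * v * c * (x ^ℚ n - 1ℚ)                              ≡⟨ cong (_* (x ^ℚ n - 1ℚ)) powers ⟩
  x ^ℚ (k ℕ.* r ℕ.+ suc k ℕ.* (k ℕ.+ r)) * (x ^ℚ n - 1ℚ)     ∎
  where
  open ≡-Reasoning
  a = x ^ℚ (suc k C 2)
  b = x ^ℚ (suc k ℕ.* r)
  c = x ^ℚ (k C 2)
  u = (1ℚ - x ^ℚ n) ÷' F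
  v = (x ^ℚ suc r) ^ℚ k
  regroup : ∀ s a u F b v c → - 1ℚ * s * a * (0ℚ + u * (F * b * (s * v * c))) ≡ s * s * (u * F) * - 1ℚ * (a * b * v * c)
  regroup = solve-∀ ℚ-ring
  negate : ∀ y w → 1ℚ * (1ℚ - y) * - 1ℚ * w ≡ w * (y - 1ℚ)
  negate = solve-∀ ℚ-ring
  powers : a * b * v * c ≡ x ^ℚ (k ℕ.* r ℕ.+ suc k ℕ.* (k ℕ.+ r))
  powers = begin
    a * b * v * c                               ≡⟨ cong (λ t → a * b * t * c) (^ℚ-assocʳ x (suc r) k) ⟩
    a * b * x ^ℚ (suc r ℕ.* k) * c              ≡⟨ cong (λ t → t * x ^ℚ (suc r ℕ.* k) * c) (sym (^ℚ-homo-* x (suc k C 2) (suc k ℕ.* r))) ⟩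
    x ^ℚ (suc k C 2 ℕ.+ suc k ℕ.* r) * x ^ℚ (suc r ℕ.* k) * c ≡⟨ cong (_* c) (sym (^ℚ-homo-* x (suc k C 2 ℕ.+ suc k ℕ.* r) (suc r ℕ.* k))) ⟩
    x ^ℚ (suc k C 2 ℕ.+ suc k ℕ.* r ℕ.+ suc r ℕ.* k) * c     ≡⟨ sym (^ℚ-homo-* x (suc k C 2 ℕ.+ suc k ℕ.* r ℕ.+ suc r ℕ.* k) (k C 2)) ⟩
    x ^ℚ (suc k C 2 ℕ.+ suc k ℕ.* r ℕ.+ suc r ℕ.* k ℕ.+ k C 2) ≡⟨ cong (x ^ℚ_) (Pk-lead-exponent k r) ⟩
    x ^ℚ (k ℕ.* r ℕ.+ suc k ℕ.* (k ℕ.+ r))      ∎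

coeff-Pk-top : ∀ {q} → q ≢ 1 → ∀ {n k} → 1 ≤ k → k ≤ n → coeff (Pk (ℕ→ℚ q) n k) k ≡ Pk-lead (ℕ→ℚ q) n k
coeff-Pk-top {q} q≢1 {n} {suc k} _ k≤n = begin
  coeff (Pk Q n (suc k)) (suc k)                            ≡⟨ coeff-Pk Q n (suc k) (suc k) ⟩
  s * (0ℚ + u * coeff (Pk-sum Q n (suc k)) (suc k))
    ≡⟨ cong (λ t → s * (0ℚ + u * t)) (coeff-sumP-upTo-top (Pk-term Q n (suc k)) (Pk-term-degreeAtMost Q n (suc k)) k) ⟩
  s * (0ℚ + u * coeff (Pk-term Q n (suc k) k) (suc k))     ≡⟨ cong (λ t → s * (0ℚ + u * t)) (coeff-Pk-term-top Q n (suc k) k) ⟩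
  s * (0ℚ + u * (Pk-weight Q n (suc k) k * P))             ≡⟨ cong (λ t → s * (0ℚ + u * (t * P))) weight ⟩
  s * (0ℚ + u * (qFact Q r * Q ^ℚ (suc k ℕ.* r) * P))      ≡⟨ Pk-lead-value Q (qFact-≢0 q≢1 r) n k r ⟩
  Q ^ℚ (k ℕ.* r ℕ.+ suc k ℕ.* (k ℕ.+ r)) * (Q ^ℚ n - 1ℚ)
    ≡⟨ cong (λ e → Q ^ℚ (k ℕ.* r ℕ.+ suc k ℕ.* e) * (Q ^ℚ n - 1ℚ)) (cong (_∸ 1) (m+[n∸m]≡n k≤n)) ⟩
  Pk-lead Q n (suc k)                                      ∎
  where
  open ≡-Reasoning
  Q = ℕ→ℚ q
  r = n ∸ suc k
  s = sign (suc k) * Q ^ℚ (suc k C 2)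
  u = (1ℚ - Q ^ℚ n) ÷' qFact Q r
  P = (- Q ^ℚ suc r) ^ℚ k * Q ^ℚ (k C 2)
  weight : Pk-weight Q n (suc k) k ≡ qFact Q r * Q ^ℚ (suc k ℕ.* r)
  weight = cong (_* Q ^ℚ (suc k ℕ.* r))
    (trans (cong (λ j → qFact Q r ÷' qFact Q j) (n∸n≡0 k)) (÷'-identityʳ (qFact Q r)))

-- The products P_α

Palpha-degreeAtMost : ∀ q n α → DegreeAtMost (Palpha q n α) (sum α)
Palpha-degreeAtMost q n α =
  subst (DegreeAtMost (Palpha q n α)) (cong sum (map-id α)) (prodP-degreeAtMost (Pk q n) id (Pk-degreeAtMost q n) α)

coeff-Palpha-zero : ∀ q n α → coeff (Palpha q n α) 0 ≡ constTerm q n α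
coeff-Palpha-zero q n α = begin
  coeff (Palpha q n α) 0                            ≡⟨ coeff-prodP-zero (map (Pk q n) α) ⟩
  prodℚ (map (λ p → coeff p 0) (map (Pk q n) α))   ≡⟨ cong prodℚ (sym (map-∘ α)) ⟩
  prodℚ (map (λ a → coeff (Pk q n a) 0) α)          ≡⟨ cong prodℚ (map-cong (coeff-Pk-zero q n) α) ⟩
  constTerm q n α                                   ∎
  where open ≡-Reasoning

coeff-Palpha-top : ∀ {q} → q ≢ 1 → ∀ n α → All (1 ≤_) α → sum α ≡ n →
  coeff (Palpha (ℕ→ℚ q) n α) n ≡ ℕ→ℚ q ^ℚ (epsilon n α ℕ.+ n ℕ.* (n ∸ 1)) * (ℕ→ℚ q ^ℚ n - 1ℚ) ^ℚ length α
coeff-Palpha-top {q} q≢1 n α α-pos Σα≡n = begin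
  coeff (Palpha Q n α) n                   ≡⟨ cong (coeff (Palpha Q n α)) (sym (trans (cong sum (map-id α)) Σα≡n)) ⟩
  coeff (Palpha Q n α) (sum (map id α))    ≡⟨ coeff-prodP-top (Pk Q n) id (Pk-degreeAtMost Q n) α ⟩
  prodℚ (map (λ a → coeff (Pk Q n a) a) α) ≡⟨ cong prodℚ (map-cong-local (All.zipWith lead (α-pos , α≤n))) ⟩
  prodℚ (map (Pk-lead Q n) α)              ≡⟨ prodℚ-map-^ℚ-* Q (Q ^ℚ n - 1ℚ) exponent α ⟩
  Q ^ℚ sum (map exponent α) * (Q ^ℚ n - 1ℚ) ^ℚ length α
    ≡⟨ cong (λ e → Q ^ℚ e * (Q ^ℚ n - 1ℚ) ^ℚ length α)
         (trans (sum-map-+ _ (ℕ._* (n ∸ 1)) α) (cong (epsilon n α ℕ.+_) (trans (sum-map-*ʳ (n ∸ 1) α) (cong (ℕ._* (n ∸ 1)) Σα≡n)))) ⟩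
  Q ^ℚ (epsilon n α ℕ.+ n ℕ.* (n ∸ 1)) * (Q ^ℚ n - 1ℚ) ^ℚ length α ∎
  where
  open ≡-Reasoning
  Q = ℕ→ℚ q
  exponent : ℕ → ℕ
  exponent a = (a ∸ 1) ℕ.* (n ∸ a) ℕ.+ a ℕ.* (n ∸ 1)
  α≤n : All (_≤ n) α
  α≤n = subst (λ m → All (_≤ m) α) Σα≡n (≤-sum α)
  lead : ∀ {a} → 1 ≤ a × a ≤ n → coeff (Pk Q n a) a ≡ Pk-lead Q n a
  lead (1≤a , a≤n) = coeff-Pk-top q≢1 1≤a a≤n

proposition4p11 : (p e q n : ℕ) → Prime p → 1 ≤ e → q ≡ p ℕ.^ e → 1 ≤ n →
    (α : List ℕ) → All (λ a → 1 ≤ a) α → sum α ≡ n →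
    HasDegree (Palpha (ℕ→ℚ q) n α) n
    × leadingCoeff (Palpha (ℕ→ℚ q) n α) n
        ≡ ((ℕ→ℚ q) ^ℚ (epsilon n α ℕ.+ n ℕ.* (n ∸ 1))) * (((ℕ→ℚ q) ^ℚ n - 1ℚ) ^ℚ length α)
    × coeff (Palpha (ℕ→ℚ q) n α) 0 ≡ constTerm (ℕ→ℚ q) n α
proposition4p11 p e .(p ℕ.^ e) n p-prime 1≤e refl 1≤n α α-pos Σα≡n =
  (lead≢0 , subst (DegreeAtMost (Palpha Q n α)) Σα≡n (Palpha-degreeAtMost Q n α)) ,
  lead≡ ,
  coeff-Palpha-zero Q n α
  where
  q≢1 : p ℕ.^ e ≢ 1
  q≢1 = prime^≢1 p-prime 1≤e
  Q = ℕ→ℚ (p ℕ.^ e)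
  lead≡ = coeff-Palpha-top q≢1 n α α-pos Σα≡n
  lead≢0 : coeff (Palpha Q n α) n ≢0
  lead≢0 = subst _≢0 (sym lead≡)
    (*-≢0 (^ℚ-≢0 (epsilon n α ℕ.+ n ℕ.* (n ∸ 1)) (ℕ→ℚ-≢0 (prime^≢0 e p-prime))) (^ℚ-≢0 (length α) (ℕ→ℚ^-1ℚ-≢0 q≢1 1≤n)))
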